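{- There exists a lazy stack paging algorithm that is not stable.
   Context: $\mathcal{A}_k$ is paging algorithm $\mathcal{A}$ on an initially empty cache of size $k$; $\mathcal{A}_k(\sigma)$ is the set of cached items after serving $\sigma\in\mathcal{U}^*$; $\textsf{Out}(\mathcal{A}_k,\tau,z):=\mathcal{A}_k(\tau)\setminus\mathcal{A}_k(\tau z)$; $\tau[X]$ is the subsequence of $\tau$ of requests to items in $X\subseteq\mathcal{U}$. Lazy: fetches only on a miss, evicts at most one item per miss, and only when full. Stable: for every $\tau\in\mathcal{U}^*$, $X\subseteq\mathcal{U}$, $z\in X$, integers $a>b\ge1$, $\textsf{Out}(\mathcal{A}_b,\tau[X],z)\cap\mathcal{A}_a(\tau z)\neq\emptyset$ implies $\mathcal{A}_b(\tau[X]z)\subseteq\mathcal{A}_a(\tau z)$. Stack algorithm: $\mathcal{A}_k(\sigma)\subseteq\mathcal{A}_{k+1}(\sigma)$ for every $\sigma$ and $k$. -}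

module Defs where

open import Data.Nat using (ℕ; suc; _≤_; _<_)
open import Data.Bool using (Bool; true)
open import Data.List using (List; []; _∷_; _∷ʳ_; length; filter)
open import Data.List.Membership.Propositional using (_∈_; _∉_)
open import Data.List.Relation.Binary.Subset.Propositional using (_⊆_)
open import Data.List.Relation.Unary.Unique.Propositional using (Unique)
open import Data.Product using (Σ; ∃; ∃-syntax; _×_)
open import Data.Sum using (_⊎_)
open import Relation.Binary.PropositionalEquality using (_≡_; _≢_)
open import Relation.Nullary using (¬_)
open import Relation.Nullary.Decidable using ()
open import Data.Bool using (_≟_)
open import Function.Bundles using (_⇔_)

Item : Set
Item = ℕ

Seq : Set
Seq = List Item

-- Cache contents are finite sets of items, represented by duplicate-free lists;
-- set-theoretic notions are read through list membership.
SameSet : List Item → List Item → Set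
SameSet A B = ∀ x → (x ∈ A) ⇔ (x ∈ B)

-- A (deterministic, online) paging algorithm 𝒜: for every cache size k ≥ 1,
-- cache k σ = 𝒜_k(σ), the set of cached items after serving σ starting
-- from the empty cache.
record PagingAlgorithm : Set where
  field
    cache   : ℕ → Seq → List Item
    initial : ∀ k → cache k [] ≡ []
    unique  : ∀ k σ → Unique (cache k σ)
    bounded : ∀ k σ → 1 ≤ k → length (cache k σ) ≤ k
    serves  : ∀ k σ z → 1 ≤ k → z ∈ cache k (σ ∷ʳ z)
open PagingAlgorithm public

IsLazy : PagingAlgorithm → Set
IsLazy 𝒜 = ∀ k σ z → 1 ≤ k →
  (z ∈ cache 𝒜 k σ → SameSet (cache 𝒜 k (σ ∷ʳ z)) (cache 𝒜 k σ)) ×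
  (z ∉ cache 𝒜 k σ →
     (length (cache 𝒜 k σ) < k → SameSet (cache 𝒜 k (σ ∷ʳ z)) (z ∷ cache 𝒜 k σ)) ×
     (length (cache 𝒜 k σ) ≡ k →
        ∃[ y ] (y ∈ cache 𝒜 k σ ×
          (∀ x → (x ∈ cache 𝒜 k (σ ∷ʳ z)) ⇔ (x ≡ z ⊎ (x ∈ cache 𝒜 k σ × x ≢ y))))))

IsStack : PagingAlgorithm → Set
IsStack 𝒜 = ∀ k σ → 1 ≤ k → cache 𝒜 k σ ⊆ cache 𝒜 (suc k) σ

restrict : Seq → (Item → Bool) → Seq
restrict τ X = filter (λ x → X x ≟ true) τ

_∈Out[_,_,_,_] : Item → PagingAlgorithm → ℕ → Seq → Item → Set
x ∈Out[ 𝒜 , k , τ , z ] = x ∈ cache 𝒜 k τ × x ∉ cache 𝒜 k (τ ∷ʳ z)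

IsStable : PagingAlgorithm → Set
IsStable 𝒜 = ∀ (τ : Seq) (X : Item → Bool) (z : Item) (a b : ℕ) →
  X z ≡ true → 1 ≤ b → b < a →
  (∃[ x ] (x ∈Out[ 𝒜 , b , restrict τ X , z ] × x ∈ cache 𝒜 a (τ ∷ʳ z))) →
  cache 𝒜 b (restrict τ X ∷ʳ z) ⊆ cache 𝒜 a (τ ∷ʳ z)

-- The cache is kept as a list whose head is the eviction slot: misses append
-- to the end until the cache is full, and afterwards every miss replaces the
-- head. With k and k + 1 slots the two caches agree up to the first
-- eviction; from then on they have the shapes h ∷ T and h′ ∷ T ∷ʳ e, the
-- larger cache keeping its extra item e at the end and holding h, which is
-- the stack property. Stability fails because the item sitting in the head
-- depends on the cache size: on τ = 0 1 2 3 the 3-cache evicts 0 and keeps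
-- 1, while on τ[{1,3,4}] = 1 3 the 2-cache is [1, 3] and the request 4
-- evicts 1, yet keeps 3, which the 3-cache no longer holds.
module Submission where

open import Defs
open import Data.Empty using (⊥-elim)
open import Data.List using (List; []; _∷_; _∷ʳ_; length; foldl; drop)
open import Data.List.Properties using (foldl-∷ʳ; length-++)
open import Data.List.Membership.Propositional using (_∈_; _∉_)
open import Data.Nat using (ℕ; suc; _≤_; _<_; _≟_; _<?_; z≤n; s≤s)
open import Data.List.Membership.DecPropositional _≟_ using (_∈?_)
open import Data.List.Membership.Propositional.Properties using (∈-++⁺ˡ; ∈-++⁺ʳ)
open import Data.List.Relation.Binary.Permutation.Propositional using (_↭_; ↭-sym)
open import Data.List.Relation.Binary.Permutation.Propositional.Properties using (∈-resp-↭; ∷↭∷ʳ)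
open import Data.List.Relation.Binary.Subset.Propositional using (_⊆_)
open import Data.List.Relation.Unary.All using ([]; _∷_)
import Data.List.Relation.Unary.All as All
open import Data.List.Relation.Unary.All.Properties using (¬Any⇒All¬)
open import Data.List.Relation.Unary.AllPairs using ([]; _∷_)
open import Data.List.Relation.Unary.Any using (here; there)
open import Data.List.Relation.Unary.Unique.Propositional using (Unique)
import Data.List.Relation.Unary.Unique.Propositional.Properties as Unique
open import Data.Nat.Properties using (+-comm; <-irrefl; ≤-antisym; ≮⇒≥; ≤-reflexive; m≤n⇒m≤1+n)
open import Data.Product using (Σ; _×_; _,_; ∃-syntax)
open import Data.Sum using (_⊎_; inj₁; inj₂)
open import Function using (_∘_)
open import Function.Bundles using (_⇔_; mk⇔)
open import Function.Construct.Identity using (⇔-id)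
open import Relation.Binary.PropositionalEquality using (_≡_; _≢_; refl; sym; trans; cong; subst)
open import Relation.Nullary using (¬_; yes; no)
open import Relation.Nullary.Decidable using (isYes; from-no; toSum)

length-∷ʳ : ∀ (C : List Item) z → length (C ∷ʳ z) ≡ suc (length C)
length-∷ʳ C z = trans (length-++ C) (+-comm (length C) 1)

↭⇒SameSet : ∀ {A B} → A ↭ B → SameSet A B
↭⇒SameSet p x = mk⇔ (∈-resp-↭ p) (∈-resp-↭ (↭-sym p))

foldl-preserves : ∀ {A B : Set} (P : A → Set) (f : A → B → A) →
  (∀ a b → P a → P (f a b)) → ∀ a bs → P a → P (foldl f a bs)
foldl-preserves P f pres a []       pa = pa
foldl-preserves P f pres a (b ∷ bs) pa = foldl-preserves P f pres (f a b) bs (pres a b pa)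

foldl-preserves₂ : ∀ {A A′ B : Set} (R : A → A′ → Set) (f : A → B → A) (g : A′ → B → A′) →
  (∀ a a′ b → R a a′ → R (f a b) (g a′ b)) →
  ∀ a a′ bs → R a a′ → R (foldl f a bs) (foldl g a′ bs)
foldl-preserves₂ R f g pres a a′ []       r = r
foldl-preserves₂ R f g pres a a′ (b ∷ bs) r =
  foldl-preserves₂ R f g pres (f a b) (g a′ b) bs (pres a a′ b r)

serve : ℕ → List Item → Item → List Item
serve k C z with z ∈? C
... | yes _ = C
... | no _ with length C <? k
...   | yes _ = C ∷ʳ z
...   | no _  = z ∷ drop 1 C

serve-hit : ∀ k C z → z ∈ C → serve k C z ≡ C
serve-hit k C z z∈C with z ∈? C
... | yes _   = refl
... | no  z∉C = ⊥-elim (z∉C z∈C)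

serve-fill : ∀ k C z → z ∉ C → length C < k → serve k C z ≡ C ∷ʳ z
serve-fill k C z z∉C room with z ∈? C
... | yes z∈C = ⊥-elim (z∉C z∈C)
... | no _ with length C <? k
...   | yes _    = refl
...   | no  full = ⊥-elim (full room)

serve-evict : ∀ k h T z → z ∉ h ∷ T → length (h ∷ T) ≡ k → serve k (h ∷ T) z ≡ z ∷ T
serve-evict k h T z z∉C full with z ∈? h ∷ T
... | yes z∈C = ⊥-elim (z∉C z∈C)
... | no _ with length (h ∷ T) <? k
...   | yes room = ⊥-elim (<-irrefl full room)
...   | no  _    = refl

serve-∈ : ∀ k C z → z ∈ serve k C z
serve-∈ k C z with z ∈? C
... | yes z∈C = z∈C
... | no _ with length C <? k
...   | yes _ = ∈-++⁺ʳ C (here refl)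
...   | no  _ = here refl

serve-unique : ∀ k C z → Unique C → Unique (serve k C z)
serve-unique k C z u with z ∈? C
... | yes _ = u
... | no z∉C with length C <? k
...   | yes _ = Unique.++⁺ u ([] ∷ []) λ { (z∈C , here refl) → z∉C z∈C }
serve-unique k []      z u       | no z∉C | no _ = [] ∷ []
serve-unique k (h ∷ T) z (_ ∷ u) | no z∉C | no _ = ¬Any⇒All¬ T (z∉C ∘ there) ∷ u

serve-length : ∀ k C z → 1 ≤ k → length C ≤ k → length (serve k C z) ≤ k
serve-length k C z 1≤k l with z ∈? C
... | yes _ = l
... | no _ with length C <? k
...   | yes room = subst (_≤ k) (sym (length-∷ʳ C z)) room
serve-length k []      z 1≤k l | no _ | no _ = 1≤k
serve-length k (h ∷ T) z 1≤k l | no _ | no _ = l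

headCache : ℕ → Seq → List Item
headCache k = foldl (serve k) []

headReplacement : PagingAlgorithm
headReplacement = record
  { cache   = headCache
  ; initial = λ k → refl
  ; unique  = λ k σ → foldl-preserves Unique (serve k) (serve-unique k) [] σ []
  ; bounded = λ k σ 1≤k →
      foldl-preserves (λ C → length C ≤ k) (serve k) (λ C z → serve-length k C z 1≤k) [] σ z≤n
  ; serves  = λ k σ z _ →
      subst (z ∈_) (sym (foldl-∷ʳ (serve k) [] z σ)) (serve-∈ k (headCache k σ) z)
  }

LazyStep : ℕ → List Item → Item → List Item → Set
LazyStep k C z C′ =
  (z ∈ C → SameSet C′ C) ×
  (z ∉ C →
     (length C < k → SameSet C′ (z ∷ C)) ×
     (length C ≡ k →
        ∃[ y ] (y ∈ C × (∀ x → (x ∈ C′) ⇔ (x ≡ z ⊎ (x ∈ C × x ≢ y))))))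

serve-evicts-head : ∀ k C z → 1 ≤ k → Unique C → z ∉ C → length C ≡ k →
  ∃[ y ] (y ∈ C × (∀ x → (x ∈ serve k C z) ⇔ (x ≡ z ⊎ (x ∈ C × x ≢ y))))
serve-evicts-head k []      z 1≤k _           _   full = ⊥-elim (<-irrefl full 1≤k)
serve-evicts-head k (h ∷ T) z _   (h∉T ∷ _) z∉C full =
  h , here refl , λ x → subst (λ C′ → (x ∈ C′) ⇔ _) (sym (serve-evict k h T z z∉C full))
                              (mk⇔ (to x) (from x))
  where
  to : ∀ x → x ∈ z ∷ T → x ≡ z ⊎ (x ∈ h ∷ T × x ≢ h)
  to x (here x≡z)  = inj₁ x≡z
  to x (there x∈T) = inj₂ (there x∈T , λ x≡h → All.lookup h∉T x∈T (sym x≡h))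
  from : ∀ x → x ≡ z ⊎ (x ∈ h ∷ T × x ≢ h) → x ∈ z ∷ T
  from x (inj₁ x≡z)              = here x≡z
  from x (inj₂ (here x≡h , x≢h)) = ⊥-elim (x≢h x≡h)
  from x (inj₂ (there x∈T , _))  = there x∈T

serve-lazy : ∀ k C z → 1 ≤ k → Unique C → LazyStep k C z (serve k C z)
serve-lazy k C z 1≤k u = hit , λ z∉C → fill z∉C , serve-evicts-head k C z 1≤k u z∉C
  where
  hit : z ∈ C → SameSet (serve k C z) C
  hit z∈C rewrite serve-hit k C z z∈C = λ x → ⇔-id (x ∈ C)
  fill : z ∉ C → length C < k → SameSet (serve k C z) (z ∷ C)
  fill z∉C room rewrite serve-fill k C z z∉C room = ↭⇒SameSet (↭-sym (∷↭∷ʳ z C))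

headReplacement-lazy : IsLazy headReplacement
headReplacement-lazy k σ z 1≤k rewrite foldl-∷ʳ (serve k) [] z σ =
  serve-lazy k (headCache k σ) z 1≤k (unique headReplacement k σ)

data Nested (k : ℕ) : List Item → List Item → Set where
  filling : ∀ {C} → length C ≤ k → Nested k C C
  full    : ∀ {h h′ e T} → length (h ∷ T) ≡ k → h ∈ h′ ∷ T ∷ʳ e →
            Nested k (h ∷ T) (h′ ∷ T ∷ʳ e)

Nested⇒⊆ : ∀ {k C C′} → Nested k C C′ → C ⊆ C′
Nested⇒⊆ (filling _)      x∈C          = x∈C
Nested⇒⊆ (full _ h∈C′)    (here refl)  = h∈C′
Nested⇒⊆ (full _ _)       (there x∈T)  = there (∈-++⁺ˡ x∈T)

serve-Nested-overflow : ∀ k C z → 1 ≤ k → z ∉ C → length C ≡ k →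
  Nested k (serve k C z) (serve (suc k) C z)
serve-Nested-overflow k []      z 1≤k z∉C l≡k = ⊥-elim (<-irrefl l≡k 1≤k)
serve-Nested-overflow k (h ∷ T) z 1≤k z∉C l≡k
  rewrite serve-evict k h T z z∉C l≡k
        | serve-fill (suc k) (h ∷ T) z z∉C (s≤s (≤-reflexive l≡k)) =
  full l≡k (∈-++⁺ʳ (h ∷ T) (here refl))

serve-Nested-filling : ∀ k C z → 1 ≤ k → length C ≤ k →
  Nested k (serve k C z) (serve (suc k) C z)
serve-Nested-filling k C z 1≤k l with toSum (z ∈? C)
... | inj₁ z∈C rewrite serve-hit k C z z∈C | serve-hit (suc k) C z z∈C = filling l
... | inj₂ z∉C with toSum (length C <? k)
...   | inj₁ room rewrite serve-fill k C z z∉C room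
                        | serve-fill (suc k) C z z∉C (m≤n⇒m≤1+n room) =
  filling (subst (_≤ k) (sym (length-∷ʳ C z)) room)
...   | inj₂ noRoom = serve-Nested-overflow k C z 1≤k z∉C (≤-antisym l (≮⇒≥ noRoom))

serve-Nested-full : ∀ k h h′ e T z → length (h ∷ T) ≡ k → h ∈ h′ ∷ T ∷ʳ e →
  Nested k (serve k (h ∷ T) z) (serve (suc k) (h′ ∷ T ∷ʳ e) z)
serve-Nested-full k h h′ e T z l h∈C′ with toSum (z ∈? h ∷ T)
... | inj₁ z∈C rewrite serve-hit k (h ∷ T) z z∈C
                     | serve-hit (suc k) (h′ ∷ T ∷ʳ e) z (Nested⇒⊆ (full l h∈C′) z∈C) =
  full l h∈C′
... | inj₂ z∉C rewrite serve-evict k h T z z∉C l with toSum (z ∈? h′ ∷ T ∷ʳ e)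
...   | inj₁ z∈C′ rewrite serve-hit (suc k) (h′ ∷ T ∷ʳ e) z z∈C′ = full l z∈C′
...   | inj₂ z∉C′ rewrite serve-evict (suc k) h′ (T ∷ʳ e) z z∉C′
                            (cong suc (trans (length-∷ʳ T e) l)) = full l (here refl)

serve-Nested : ∀ k C C′ z → 1 ≤ k → Nested k C C′ →
  Nested k (serve k C z) (serve (suc k) C′ z)
serve-Nested k C .C z 1≤k (filling l) = serve-Nested-filling k C z 1≤k l
serve-Nested k .(h ∷ T) .(h′ ∷ T ∷ʳ e) z 1≤k (full {h} {h′} {e} {T} l h∈C′) =
  serve-Nested-full k h h′ e T z l h∈C′

headReplacement-stack : IsStack headReplacement
headReplacement-stack k σ 1≤k = Nested⇒⊆
  (foldl-preserves₂ (Nested k) (serve k) (serve (suc k))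
    (λ C C′ z → serve-Nested k C C′ z 1≤k) [] [] σ (filling z≤n))

headReplacement-unstable : ¬ IsStable headReplacement
headReplacement-unstable stable = from-no (3 ∈? 4 ∷ 1 ∷ 2 ∷ []) 3∈
  where
  3∈ : 3 ∈ 4 ∷ 1 ∷ 2 ∷ []
  3∈ = stable (0 ∷ 1 ∷ 2 ∷ 3 ∷ []) (λ x → isYes (x ∈? 1 ∷ 3 ∷ 4 ∷ [])) 4 3 2
         refl (s≤s z≤n) (s≤s (s≤s (s≤s z≤n)))
         (1 , (here refl , from-no (1 ∈? 4 ∷ 3 ∷ [])) , there (here refl))
         (there (here refl))

proposition20 : Σ PagingAlgorithm (λ 𝒜 → IsLazy 𝒜 × IsStack 𝒜 × ¬ IsStable 𝒜)
proposition20 = headReplacement , headReplacement-lazy , headReplacement-stack , headReplacement-unstable
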